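{- For every $n\in\mathbb{N}$ and every $f\in\mathsf{CNOT}(0,n)$, either $f$ is total (i.e. $ff^\circ=1_0$) or $f$ is degenerate, i.e. $f=\Omega_{0,n}$.
   Context: $\mathsf{CNOT}$ is the strict symmetric monoidal category with objects the natural numbers ($n\otimes m=n+m$) generated by $\mathsf{cnot}:2\to2$, $|1\rangle:0\to1$, $\langle1|:1\to0$ (and symmetry $\sigma$) modulo exactly the following identities (diagrammatic composition, $fg$ = first $f$ then $g$; $C_{i\to j}$ the cnot with control wire $i$, target wire $j$; $\mathsf{cnot}=C_{1\to2}$): $C_{1\to2}C_{2\to1}C_{1\to2}=\sigma$; $C_{1\to2}C_{1\to2}=1_2$; $C_{2\to1}C_{2\to3}=C_{2\to3}C_{2\to1}$; $(|1\rangle\otimes1)C_{1\to2}=(|1\rangle\otimes1)C_{1\to2}(\langle1|\otimes1)(|1\rangle\otimes1)$ and $C_{1\to2}(\langle1|\otimes1)=(\langle1|\otimes1)(|1\rangle\otimes1)C_{1\to2}(\langle1|\otimes1)$; $C_{1\to2}C_{3\to2}=C_{3\to2}C_{1\to2}$; $|1\rangle\langle1|=1_0$; $(|1\rangle\otimes|1\rangle\otimes1)C_{1\to2}C_{2\to3}(\langle1|\otimes1_2)=(|1\rangle\otimes|1\rangle\otimes1)C_{1\to2}(\langle1|\otimes1_2)$ and $(|1\rangle\otimes1_2)C_{2\to3}C_{1\to2}(\langle1|\otimes\langle1|\otimes1)=(|1\rangle\otimes1_2)C_{1\to2}(\langle1|\otimes\langle1|\otimes1)$; $C_{1\to2}C_{2\to3}C_{1\to2}=C_{2\to3}C_{1\to3}$;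 $(|1\rangle\otimes|1\rangle\otimes1)C_{1\to2}(\langle1|\otimes\langle1|\otimes1)=(|1\rangle\otimes|1\rangle\otimes\langle1|)C_{1\to2}(\langle1|\otimes\langle1|\otimes|1\rangle)$. The horizontal flip $(-)^\circ:\mathsf{CNOT}^{op}\to\mathsf{CNOT}$ is the identity-on-objects monoidal functor fixing $\mathsf{cnot},\sigma$ and exchanging $|1\rangle,\langle1|$; the restriction of $f$ is $\overline f=ff^\circ$ and $f$ is total if $\overline f$ is an identity. $\Omega:=(|1\rangle\otimes|1\rangle)\mathsf{cnot}(\langle1|\otimes\langle1|):0\to0$ and $\Omega_{n,m}:=(\otimes^n\langle1|)\Omega(\otimes^m|1\rangle):n\to m$, so $\Omega_{0,n}=\Omega(\otimes^n|1\rangle)$. -}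

module Defs where

open import Data.Nat using (ℕ; zero; suc; _+_)
open import Data.Nat.Properties using (+-assoc; +-identityʳ)
open import Relation.Binary.PropositionalEquality using (_≡_; refl; sym; subst₂)

infixr 9 _⨾_
infixr 10 _⊗_

-- Raw syntax of morphisms of the free strict symmetric monoidal category
-- (objects ℕ, n ⊗ m = n + m) on the generators cnot, |1⟩, ⟨1|.
-- Composition is diagrammatic: f ⨾ g = first f then g.
data Tm : ℕ → ℕ → Set where
  id   : (n : ℕ) → Tm n n
  _⨾_  : {a b c : ℕ} → Tm a b → Tm b c → Tm a c
  _⊗_  : {a b c d : ℕ} → Tm a b → Tm c d → Tm (a + c) (b + d)
  σ    : (a b : ℕ) → Tm (a + b) (b + a)
  cnot : Tm 2 2
  ket1 : Tm 0 1
  bra1 : Tm 1 0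

cast : {a a' b b' : ℕ} → a ≡ a' → b ≡ b' → Tm a b → Tm a' b'
cast p q f = subst₂ Tm p q f

sw : Tm 2 2
sw = σ 1 1

C12 : Tm 2 2
C12 = cnot

C21 : Tm 2 2
C21 = sw ⨾ cnot ⨾ sw

C12₃ : Tm 3 3
C12₃ = cnot ⊗ id 1

C21₃ : Tm 3 3
C21₃ = C21 ⊗ id 1

C23₃ : Tm 3 3
C23₃ = id 1 ⊗ cnot

C32₃ : Tm 3 3
C32₃ = id 1 ⊗ C21

C13₃ : Tm 3 3
C13₃ = (id 1 ⊗ sw) ⨾ C12₃ ⨾ (id 1 ⊗ sw)

infix 4 _≈_

-- The congruence presenting CNOT: strict symmetric monoidal category laws
-- plus exactly the identities listed in the paper.
data _≈_ : {a b : ℕ} → Tm a b → Tm a b → Set where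
  ≈-refl  : ∀ {a b} {f : Tm a b} → f ≈ f
  ≈-sym   : ∀ {a b} {f g : Tm a b} → f ≈ g → g ≈ f
  ≈-trans : ∀ {a b} {f g h : Tm a b} → f ≈ g → g ≈ h → f ≈ h
  ⨾-cong  : ∀ {a b c} {f f' : Tm a b} {g g' : Tm b c} → f ≈ f' → g ≈ g' → f ⨾ g ≈ f' ⨾ g'
  ⊗-cong  : ∀ {a b c d} {f f' : Tm a b} {g g' : Tm c d} → f ≈ f' → g ≈ g' → f ⊗ g ≈ f' ⊗ g'
  ⨾-assoc : ∀ {a b c d} (f : Tm a b) (g : Tm b c) (h : Tm c d) → (f ⨾ g) ⨾ h ≈ f ⨾ (g ⨾ h)
  ⨾-idˡ   : ∀ {a b} (f : Tm a b) → id a ⨾ f ≈ f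
  ⨾-idʳ   : ∀ {a b} (f : Tm a b) → f ⨾ id b ≈ f
  ⊗-id    : ∀ a b → id a ⊗ id b ≈ id (a + b)
  ⊗-interchange : ∀ {a b c d e g} (f : Tm a b) (f' : Tm b c) (h : Tm d e) (h' : Tm e g) →
            (f ⊗ h) ⨾ (f' ⊗ h') ≈ (f ⨾ f') ⊗ (h ⨾ h')
  ⊗-assoc : ∀ {a b c d e g} (f : Tm a b) (h : Tm c d) (k : Tm e g) →
            cast (+-assoc a c e) (+-assoc b d g) ((f ⊗ h) ⊗ k) ≈ f ⊗ (h ⊗ k)
  ⊗-unitˡ : ∀ {a b} (f : Tm a b) → id 0 ⊗ f ≈ f
  ⊗-unitʳ : ∀ {a b} (f : Tm a b) → cast (+-identityʳ a) (+-identityʳ b) (f ⊗ id 0) ≈ f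
  σ-nat   : ∀ {a b c d} (f : Tm a b) (g : Tm c d) → (f ⊗ g) ⨾ σ b d ≈ σ a c ⨾ (g ⊗ f)
  σ-inv   : ∀ a b → σ a b ⨾ σ b a ≈ id (a + b)
  σ-unit  : ∀ a → cast (+-identityʳ a) refl (σ a 0) ≈ id a
  σ-hex   : ∀ a b c → σ a (b + c) ≈
            cast refl (sym (+-assoc b c a))
              (cast (+-assoc a b c) (+-assoc b a c) (σ a b ⊗ id c) ⨾ (id b ⊗ σ a c))
  ax1  : C12 ⨾ C21 ⨾ C12 ≈ sw
  ax2  : C12 ⨾ C12 ≈ id 2
  ax3  : C21₃ ⨾ C23₃ ≈ C23₃ ⨾ C21₃
  ax4a : (ket1 ⊗ id 1) ⨾ C12 ≈ (ket1 ⊗ id 1) ⨾ C12 ⨾ (bra1 ⊗ id 1) ⨾ (ket1 ⊗ id 1)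
  ax4b : C12 ⨾ (bra1 ⊗ id 1) ≈ (bra1 ⊗ id 1) ⨾ (ket1 ⊗ id 1) ⨾ C12 ⨾ (bra1 ⊗ id 1)
  ax5  : C12₃ ⨾ C32₃ ≈ C32₃ ⨾ C12₃
  ax6  : ket1 ⨾ bra1 ≈ id 0
  ax7a : (ket1 ⊗ ket1 ⊗ id 1) ⨾ C12₃ ⨾ C23₃ ⨾ (bra1 ⊗ id 2)
         ≈ (ket1 ⊗ ket1 ⊗ id 1) ⨾ C12₃ ⨾ (bra1 ⊗ id 2)
  ax7b : (ket1 ⊗ id 2) ⨾ C23₃ ⨾ C12₃ ⨾ (bra1 ⊗ bra1 ⊗ id 1)
         ≈ (ket1 ⊗ id 2) ⨾ C12₃ ⨾ (bra1 ⊗ bra1 ⊗ id 1)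
  ax8  : C12₃ ⨾ C23₃ ⨾ C12₃ ≈ C23₃ ⨾ C13₃
  ax9  : (ket1 ⊗ ket1 ⊗ id 1) ⨾ C12₃ ⨾ (bra1 ⊗ bra1 ⊗ id 1)
         ≈ (ket1 ⊗ ket1 ⊗ bra1) ⨾ C12 ⨾ (bra1 ⊗ bra1 ⊗ ket1)

_° : {a b : ℕ} → Tm a b → Tm b a
id n ° = id n
(f ⨾ g) ° = g ° ⨾ f °
(f ⊗ g) ° = f ° ⊗ g °
σ a b ° = σ b a
cnot ° = cnot
ket1 ° = bra1
bra1 ° = ket1

restr : {a b : ℕ} → Tm a b → Tm a a
restr f = f ⨾ f °

Total : {a b : ℕ} → Tm a b → Set
Total {a} f = restr f ≈ id a

Ω : Tm 0 0
Ω = (ket1 ⊗ ket1) ⨾ cnot ⨾ (bra1 ⊗ bra1)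

kets : (n : ℕ) → Tm 0 n
kets zero = id 0
kets (suc n) = ket1 ⊗ kets n

Ω0 : (n : ℕ) → Tm 0 n
Ω0 n = Ω ⨾ kets n

-- Interpret |0⟩ := (|1⟩ ⊗ |1⟩) cnot (⟨1| ⊗ 1) and write |v⟩ for the
-- computational basis state of a bit vector v. Every generator either maps a
-- basis state |u⟩ to a basis state |v⟩ whose flipped image is |u⟩ again, or
-- (only ⟨1| applied to |0⟩) collapses it to Ω; the axioms make Ω idempotent
-- and make Ω |v⟩ independent of v, so a collapsed state stays collapsed,
-- becoming Ω_{0,n}. By induction on terms this holds for every morphism, and
-- a state f : 0 → n is the image of the empty basis state |⟩ = 1₀: it is
-- total in the first case and equal to Ω_{0,n} in the second.
module Submission where

open import Defs
open import Data.Bool using (Bool; true; false; _xor_)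
open import Data.Bool.Properties using (xor-assoc; xor-same)
open import Data.Nat using (ℕ; zero; suc; _+_)
open import Data.Product using (_,_)
open import Data.Sum using (_⊎_; inj₁; inj₂)
open import Data.Vec using (Vec; []; _∷_; _++_; splitAt; replicate)
open import Level using (0ℓ)
open import Relation.Binary.Bundles using (Setoid)
open import Relation.Binary.PropositionalEquality using (_≡_; refl; sym; trans; cong)

homSetoid : ℕ → ℕ → Setoid 0ℓ 0ℓ
homSetoid a b = record
  { Carrier       = Tm a b
  ; _≈_           = _≈_
  ; isEquivalence = record { refl = ≈-refl ; sym = ≈-sym ; trans = ≈-trans }
  }

module ≈-Reasoning {a b : ℕ} where
  open import Relation.Binary.Reasoning.Setoid (homSetoid a b) public

open ≈-Reasoning

≡⇒≈ : ∀ {a b} {f g : Tm a b} → f ≡ g → f ≈ g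
≡⇒≈ refl = ≈-refl

⨾-congˡ : ∀ {a b c} {f : Tm a b} {g g' : Tm b c} → g ≈ g' → f ⨾ g ≈ f ⨾ g'
⨾-congˡ = ⨾-cong ≈-refl

⨾-congʳ : ∀ {a b c} {f f' : Tm a b} {g : Tm b c} → f ≈ f' → f ⨾ g ≈ f' ⨾ g
⨾-congʳ p = ⨾-cong p ≈-refl

⨾-assoc˘ : ∀ {a b c d} (f : Tm a b) (g : Tm b c) (h : Tm c d) → f ⨾ (g ⨾ h) ≈ (f ⨾ g) ⨾ h
⨾-assoc˘ f g h = ≈-sym (⨾-assoc f g h)

⨾-chain : ∀ {a b c d} {s : Tm a b} {g : Tm b c} {h : Tm c d} {t : Tm a c} {r : Tm a d} →
          s ⨾ g ≈ t → t ⨾ h ≈ r → s ⨾ (g ⨾ h) ≈ r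
⨾-chain {s = s} {g} {h} p q = ≈-trans (⨾-assoc˘ s g h) (≈-trans (⨾-congʳ p) q)

⊗-interchange˘ : ∀ {a b c d e g} (f : Tm a b) (f' : Tm b c) (h : Tm d e) (h' : Tm e g) →
                 (f ⨾ f') ⊗ (h ⨾ h') ≈ (f ⊗ h) ⨾ (f' ⊗ h')
⊗-interchange˘ f f' h h' = ≈-sym (⊗-interchange f f' h h')

⨾-⊗-idʳ : ∀ {a b c} (f : Tm a b) (g : Tm b c) (n : ℕ) → (f ⨾ g) ⊗ id n ≈ (f ⊗ id n) ⨾ (g ⊗ id n)
⨾-⊗-idʳ f g n = ≈-trans (⊗-cong ≈-refl (≈-sym (⨾-idˡ (id n)))) (⊗-interchange˘ f g (id n) (id n))

⊗-id-slide : ∀ {a b c d} (f : Tm a b) (g : Tm c d) → (f ⊗ id c) ⨾ (id b ⊗ g) ≈ (id a ⊗ g) ⨾ (f ⊗ id d)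
⊗-id-slide {a} {b} {c} {d} f g = begin
  (f ⊗ id c) ⨾ (id b ⊗ g) ≈⟨ ⊗-interchange f (id b) (id c) g ⟩
  (f ⨾ id b) ⊗ (id c ⨾ g) ≈⟨ ⊗-cong (≈-trans (⨾-idʳ f) (≈-sym (⨾-idˡ f)))
                                    (≈-trans (⨾-idˡ g) (≈-sym (⨾-idʳ g))) ⟩
  (id a ⨾ f) ⊗ (g ⨾ id d) ≈⟨ ⊗-interchange˘ (id a) f g (id d) ⟩
  (id a ⊗ g) ⨾ (f ⊗ id d) ∎

state-⊗ˡ : ∀ {a b c d} (s : Tm 0 a) (f : Tm b c) (t : Tm c d) → s ⊗ (f ⨾ t) ≈ f ⨾ (s ⊗ t)
state-⊗ˡ s f t = begin
  s ⊗ (f ⨾ t)          ≈⟨ ⊗-cong (≈-sym (⨾-idˡ s)) ≈-refl ⟩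
  (id 0 ⨾ s) ⊗ (f ⨾ t) ≈⟨ ⊗-interchange˘ (id 0) s f t ⟩
  (id 0 ⊗ f) ⨾ (s ⊗ t) ≈⟨ ⨾-congʳ (⊗-unitˡ f) ⟩
  f ⨾ (s ⊗ t)          ∎

effect-⊗ˡ : ∀ {a b c d} (e : Tm a 0) (t : Tm b c) (f : Tm c d) → e ⊗ (t ⨾ f) ≈ (e ⊗ t) ⨾ f
effect-⊗ˡ e t f = begin
  e ⊗ (t ⨾ f)          ≈⟨ ⊗-cong (≈-sym (⨾-idʳ e)) ≈-refl ⟩
  (e ⨾ id 0) ⊗ (t ⨾ f) ≈⟨ ⊗-interchange˘ e (id 0) t f ⟩
  (e ⊗ t) ⨾ (id 0 ⊗ f) ≈⟨ ⨾-congˡ (⊗-unitˡ f) ⟩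
  (e ⊗ t) ⨾ f          ∎

state-⊗ : ∀ {a b} (s : Tm 0 a) (t : Tm 0 b) → s ⊗ t ≈ t ⨾ (s ⊗ id b)
state-⊗ {b = b} s t = ≈-trans (⊗-cong ≈-refl (≈-sym (⨾-idʳ t))) (state-⊗ˡ s t (id b))

scalar-⨾-⊗ : ∀ {a b} (z : Tm 0 0) (s : Tm 0 a) (t : Tm 0 b) → z ⨾ (s ⊗ t) ≈ (z ⨾ s) ⊗ t
scalar-⨾-⊗ z s t = begin
  z ⨾ (s ⊗ t)          ≈⟨ ⨾-congʳ (≈-sym (⊗-unitʳ z)) ⟩
  (z ⊗ id 0) ⨾ (s ⊗ t) ≈⟨ ⊗-interchange z s (id 0) t ⟩
  (z ⨾ s) ⊗ (id 0 ⨾ t) ≈⟨ ⊗-cong ≈-refl (⨾-idˡ t) ⟩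
  (z ⨾ s) ⊗ t          ∎

scalar-⊗ : ∀ {a} (z : Tm 0 0) (t : Tm 0 a) → z ⊗ t ≈ z ⨾ t
scalar-⊗ z t = begin
  z ⊗ t               ≈⟨ ⊗-cong (≈-sym (⨾-idʳ z)) ≈-refl ⟩
  (z ⨾ id 0) ⊗ t      ≈⟨ ≈-sym (scalar-⨾-⊗ z (id 0) t) ⟩
  z ⨾ (id 0 ⊗ t)      ≈⟨ ⨾-congˡ (⊗-unitˡ t) ⟩
  z ⨾ t               ∎

ket0 : Tm 0 1
ket0 = (ket1 ⊗ ket1) ⨾ cnot ⨾ (bra1 ⊗ id 1)

-- The NOT gate, by axioms 4a/4b.
X : Tm 1 1
X = (ket1 ⊗ id 1) ⨾ cnot ⨾ (bra1 ⊗ id 1)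

ket1-⊗-id : ket1 ⊗ ket1 ≈ ket1 ⨾ (ket1 ⊗ id 1)
ket1-⊗-id = state-⊗ ket1 ket1

X-ket1 : ket1 ⨾ X ≈ ket0
X-ket1 = ≈-trans (⨾-assoc˘ ket1 (ket1 ⊗ id 1) _) (⨾-congʳ (≈-sym ket1-⊗-id))

ket1-control : (ket1 ⊗ id 1) ⨾ cnot ≈ X ⨾ (ket1 ⊗ id 1)
ket1-control = ≈-trans ax4a (≈-trans (⨾-congˡ (⨾-assoc˘ cnot _ _)) (⨾-assoc˘ (ket1 ⊗ id 1) _ _))

ket0-bra1 : ket0 ⨾ bra1 ≈ Ω
ket0-bra1 = begin
  ((ket1 ⊗ ket1) ⨾ cnot ⨾ (bra1 ⊗ id 1)) ⨾ bra1 ≈⟨ ⨾-assoc _ _ bra1 ⟩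
  (ket1 ⊗ ket1) ⨾ (cnot ⨾ (bra1 ⊗ id 1)) ⨾ bra1 ≈⟨ ⨾-congˡ (⨾-assoc cnot _ bra1) ⟩
  (ket1 ⊗ ket1) ⨾ cnot ⨾ (bra1 ⊗ id 1) ⨾ bra1   ≈⟨ ⨾-congˡ (⨾-congˡ (≈-sym bra1-bra1)) ⟩
  Ω                                             ∎
  where
  bra1-bra1 : bra1 ⊗ bra1 ≈ (bra1 ⊗ id 1) ⨾ bra1
  bra1-bra1 = ≈-trans (⊗-cong ≈-refl (≈-sym (⨾-idˡ bra1))) (effect-⊗ˡ bra1 (id 1) bra1)

cnot-ket1-ket1 : (ket1 ⊗ ket1) ⨾ cnot ≈ ket1 ⊗ ket0
cnot-ket1-ket1 = begin
  (ket1 ⊗ ket1) ⨾ cnot             ≈⟨ ⨾-congʳ ket1-⊗-id ⟩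
  (ket1 ⨾ (ket1 ⊗ id 1)) ⨾ cnot    ≈⟨ ⨾-assoc ket1 _ cnot ⟩
  ket1 ⨾ (ket1 ⊗ id 1) ⨾ cnot      ≈⟨ ⨾-congˡ ket1-control ⟩
  ket1 ⨾ X ⨾ (ket1 ⊗ id 1)         ≈⟨ ⨾-assoc˘ ket1 X _ ⟩
  (ket1 ⨾ X) ⨾ (ket1 ⊗ id 1)       ≈⟨ ⨾-congʳ X-ket1 ⟩
  ket0 ⨾ (ket1 ⊗ id 1)             ≈⟨ ≈-sym (state-⊗ ket1 ket0) ⟩
  ket1 ⊗ ket0                      ∎

cnot-ket1-ket0 : (ket1 ⊗ ket0) ⨾ cnot ≈ ket1 ⊗ ket1
cnot-ket1-ket0 = begin
  (ket1 ⊗ ket0) ⨾ cnot             ≈⟨ ⨾-congʳ (≈-sym cnot-ket1-ket1) ⟩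
  ((ket1 ⊗ ket1) ⨾ cnot) ⨾ cnot    ≈⟨ ⨾-assoc _ cnot cnot ⟩
  (ket1 ⊗ ket1) ⨾ cnot ⨾ cnot      ≈⟨ ⨾-congˡ ax2 ⟩
  (ket1 ⊗ ket1) ⨾ id 2             ≈⟨ ⨾-idʳ _ ⟩
  ket1 ⊗ ket1                      ∎

cnot-ket0-control : (t : Tm 0 1) → (ket0 ⊗ t) ⨾ cnot ≈ ket0 ⊗ t
cnot-ket0-control t = begin
  (ket0 ⊗ t) ⨾ cnot             ≈⟨ ⨾-congʳ (state-⊗ ket0 t) ⟩
  (t ⨾ (ket0 ⊗ id 1)) ⨾ cnot    ≈⟨ ⨾-assoc t _ cnot ⟩
  t ⨾ (ket0 ⊗ id 1) ⨾ cnot      ≈⟨ ⨾-congˡ control0 ⟩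
  t ⨾ (ket0 ⊗ id 1)             ≈⟨ ≈-sym (state-⊗ ket0 t) ⟩
  ket0 ⊗ t                      ∎
  where
  K : Tm 1 3
  K = ket1 ⊗ ket1 ⊗ id 1

  B : Tm 3 2
  B = bra1 ⊗ id 2

  ket0-⊗-id : ket0 ⊗ id 1 ≈ K ⨾ C12₃ ⨾ B
  ket0-⊗-id = begin
    ket0 ⊗ id 1                                         ≈⟨ ⨾-⊗-idʳ (ket1 ⊗ ket1) _ 1 ⟩
    ((ket1 ⊗ ket1) ⊗ id 1) ⨾ ((cnot ⨾ (bra1 ⊗ id 1)) ⊗ id 1)
                                                        ≈⟨ ⨾-cong (⊗-assoc ket1 ket1 (id 1)) (⨾-⊗-idʳ cnot _ 1) ⟩
    K ⨾ C12₃ ⨾ ((bra1 ⊗ id 1) ⊗ id 1)                   ≈⟨ ⨾-congˡ (⨾-congˡ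
                                                             (≈-trans (⊗-assoc bra1 (id 1) (id 1))
                                                                      (⊗-cong ≈-refl (⊗-id 1 1)))) ⟩
    K ⨾ C12₃ ⨾ B                                        ∎

  B-cnot : B ⨾ cnot ≈ C23₃ ⨾ B
  B-cnot = ≈-trans (⨾-congˡ (≈-sym (⊗-unitˡ cnot))) (⊗-id-slide bra1 cnot)

  control0 : (ket0 ⊗ id 1) ⨾ cnot ≈ ket0 ⊗ id 1
  control0 = begin
    (ket0 ⊗ id 1) ⨾ cnot          ≈⟨ ⨾-congʳ ket0-⊗-id ⟩
    (K ⨾ C12₃ ⨾ B) ⨾ cnot         ≈⟨ ≈-trans (⨾-assoc K _ cnot) (⨾-congˡ (⨾-assoc C12₃ B cnot)) ⟩
    K ⨾ C12₃ ⨾ B ⨾ cnot           ≈⟨ ⨾-congˡ (⨾-congˡ B-cnot) ⟩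
    K ⨾ C12₃ ⨾ C23₃ ⨾ B           ≈⟨ ax7a ⟩
    K ⨾ C12₃ ⨾ B                  ≈⟨ ≈-sym ket0-⊗-id ⟩
    ket0 ⊗ id 1                   ∎

Ω-ket1≈Ω-ket0 : Ω ⨾ ket1 ≈ Ω ⨾ ket0
Ω-ket1≈Ω-ket0 = begin
  Ω ⨾ ket1                        ≈⟨ ≈-sym P-bra1 ⟩
  P ⨾ (bra1 ⊗ id 1)               ≈⟨ ⨾-congʳ (≈-sym (cnot-ket0-control ket1)) ⟩
  (P ⨾ cnot) ⨾ (bra1 ⊗ id 1)      ≈⟨ ⨾-assoc P cnot _ ⟩
  P ⨾ cnot ⨾ (bra1 ⊗ id 1)        ≈⟨ ⨾-congˡ ax4b ⟩
  P ⨾ (bra1 ⊗ id 1) ⨾ X           ≈⟨ ⨾-assoc˘ P _ X ⟩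
  (P ⨾ (bra1 ⊗ id 1)) ⨾ X         ≈⟨ ⨾-congʳ P-bra1 ⟩
  (Ω ⨾ ket1) ⨾ X                  ≈⟨ ⨾-assoc Ω ket1 X ⟩
  Ω ⨾ ket1 ⨾ X                    ≈⟨ ⨾-congˡ X-ket1 ⟩
  Ω ⨾ ket0                        ∎
  where
  P : Tm 0 2
  P = ket0 ⊗ ket1

  P-bra1 : P ⨾ (bra1 ⊗ id 1) ≈ Ω ⨾ ket1
  P-bra1 = begin
    (ket0 ⊗ ket1) ⨾ (bra1 ⊗ id 1) ≈⟨ ⊗-interchange ket0 bra1 ket1 (id 1) ⟩
    (ket0 ⨾ bra1) ⊗ (ket1 ⨾ id 1) ≈⟨ ⊗-cong ket0-bra1 (⨾-idʳ ket1) ⟩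
    Ω ⊗ ket1                      ≈⟨ scalar-⊗ Ω ket1 ⟩
    Ω ⨾ ket1                      ∎

Ω-⊗-id : Ω ⊗ id 1 ≈ bra1 ⨾ Ω ⨾ ket1
Ω-⊗-id = begin
  Ω ⊗ id 1                                           ≈⟨ ⨾-⊗-idʳ (ket1 ⊗ ket1) _ 1 ⟩
  ((ket1 ⊗ ket1) ⊗ id 1) ⨾ ((cnot ⨾ (bra1 ⊗ bra1)) ⊗ id 1)
                                                     ≈⟨ ⨾-cong (⊗-assoc ket1 ket1 (id 1)) (⨾-⊗-idʳ cnot _ 1) ⟩
  (ket1 ⊗ ket1 ⊗ id 1) ⨾ C12₃ ⨾ ((bra1 ⊗ bra1) ⊗ id 1)
                                                     ≈⟨ ⨾-congˡ (⨾-congˡ (⊗-assoc bra1 bra1 (id 1))) ⟩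
  (ket1 ⊗ ket1 ⊗ id 1) ⨾ C12₃ ⨾ (bra1 ⊗ bra1 ⊗ id 1) ≈⟨ ax9 ⟩
  (ket1 ⊗ ket1 ⊗ bra1) ⨾ cnot ⨾ (bra1 ⊗ bra1 ⊗ ket1) ≈⟨ ⨾-cong kets-bra1 (⨾-congˡ bras-ket1) ⟩
  (bra1 ⨾ (ket1 ⊗ ket1)) ⨾ cnot ⨾ (bra1 ⊗ bra1) ⨾ ket1
                                                     ≈⟨ ⨾-assoc bra1 _ _ ⟩
  bra1 ⨾ (ket1 ⊗ ket1) ⨾ cnot ⨾ (bra1 ⊗ bra1) ⨾ ket1 ≈⟨ ⨾-congˡ (≈-trans (⨾-congˡ (⨾-assoc˘ cnot _ ket1))
                                                                          (⨾-assoc˘ (ket1 ⊗ ket1) _ ket1)) ⟩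
  bra1 ⨾ Ω ⨾ ket1                                    ∎
  where
  kets-bra1 : ket1 ⊗ ket1 ⊗ bra1 ≈ bra1 ⨾ (ket1 ⊗ ket1)
  kets-bra1 = ≈-trans (⊗-cong ≈-refl ket1-bra1) (state-⊗ˡ ket1 bra1 ket1)
    where
    ket1-bra1 : ket1 ⊗ bra1 ≈ bra1 ⨾ ket1
    ket1-bra1 = ≈-trans (⊗-cong ≈-refl (≈-sym (⨾-idʳ bra1)))
                        (≈-trans (state-⊗ˡ ket1 bra1 (id 0)) (⨾-congˡ (⊗-unitʳ ket1)))

  bras-ket1 : bra1 ⊗ bra1 ⊗ ket1 ≈ (bra1 ⊗ bra1) ⨾ ket1
  bras-ket1 = ≈-trans (⊗-cong ≈-refl bra1-ket1) (effect-⊗ˡ bra1 bra1 ket1)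
    where
    bra1-ket1 : bra1 ⊗ ket1 ≈ bra1 ⨾ ket1
    bra1-ket1 = ≈-trans (⊗-cong ≈-refl (≈-sym (⨾-idˡ ket1)))
                        (≈-trans (effect-⊗ˡ bra1 (id 0) ket1) (⨾-congʳ (⊗-unitʳ bra1)))

Ω-idem : Ω ⨾ Ω ≈ Ω
Ω-idem = begin
  Ω ⨾ Ω                        ≈⟨ ≈-sym (ket1-bra1-cancel (Ω ⨾ Ω)) ⟩
  ((Ω ⨾ Ω) ⨾ ket1) ⨾ bra1      ≈⟨ ⨾-congʳ (⨾-assoc Ω Ω ket1) ⟩
  (Ω ⨾ Ω ⨾ ket1) ⨾ bra1        ≈⟨ ⨾-congʳ (≈-sym Ω-ket0) ⟩
  (Ω ⨾ ket0) ⨾ bra1            ≈⟨ ⨾-congʳ (≈-sym Ω-ket1≈Ω-ket0) ⟩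
  (Ω ⨾ ket1) ⨾ bra1            ≈⟨ ket1-bra1-cancel Ω ⟩
  Ω                            ∎
  where
  ket1-bra1-cancel : ∀ {a} (f : Tm a 0) → (f ⨾ ket1) ⨾ bra1 ≈ f
  ket1-bra1-cancel f = ≈-trans (⨾-assoc f ket1 bra1) (≈-trans (⨾-congˡ ax6) (⨾-idʳ f))

  Ω-ket0 : Ω ⨾ ket0 ≈ Ω ⨾ Ω ⨾ ket1
  Ω-ket0 = begin
    Ω ⨾ ket0                 ≈⟨ ≈-sym (scalar-⊗ Ω ket0) ⟩
    Ω ⊗ ket0                 ≈⟨ state-⊗ Ω ket0 ⟩
    ket0 ⨾ (Ω ⊗ id 1)        ≈⟨ ⨾-congˡ Ω-⊗-id ⟩
    ket0 ⨾ bra1 ⨾ Ω ⨾ ket1   ≈⟨ ⨾-assoc˘ ket0 bra1 _ ⟩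
    (ket0 ⨾ bra1) ⨾ Ω ⨾ ket1 ≈⟨ ⨾-congʳ ket0-bra1 ⟩
    Ω ⨾ Ω ⨾ ket1             ∎

ket : Bool → Tm 0 1
ket true  = ket1
ket false = ket0

basis : ∀ {n} → Vec Bool n → Tm 0 n
basis []      = id 0
basis (b ∷ v) = ket b ⊗ basis v

basis-++ : ∀ {n m} (u : Vec Bool n) (v : Vec Bool m) → basis (u ++ v) ≈ basis u ⊗ basis v
basis-++ []      v = ≈-sym (⊗-unitˡ (basis v))
basis-++ (b ∷ u) v = ≈-trans (⊗-cong ≈-refl (basis-++ u v)) (≈-sym (⊗-assoc (ket b) (basis u) (basis v)))

kets≈basis : ∀ n → kets n ≈ basis (replicate n true)
kets≈basis zero    = ≈-refl
kets≈basis (suc n) = ⊗-cong ≈-refl (kets≈basis n)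

Ω-absorbs-basis : ∀ {n} (v : Vec Bool n) → Ω ⨾ basis v ≈ Ω0 n
Ω-absorbs-basis []               = ≈-refl
Ω-absorbs-basis {suc n} (b ∷ v) = begin
  Ω ⨾ (ket b ⊗ basis v)  ≈⟨ scalar-⨾-⊗ Ω (ket b) (basis v) ⟩
  (Ω ⨾ ket b) ⊗ basis v  ≈⟨ ⊗-cong (Ω-ket b) ≈-refl ⟩
  (Ω ⨾ ket1) ⊗ basis v   ≈⟨ ≈-sym (scalar-⨾-⊗ Ω ket1 (basis v)) ⟩
  Ω ⨾ (ket1 ⊗ basis v)   ≈⟨ ≈-sym (state-⊗ˡ ket1 Ω (basis v)) ⟩
  ket1 ⊗ (Ω ⨾ basis v)   ≈⟨ ⊗-cong ≈-refl (Ω-absorbs-basis v) ⟩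
  ket1 ⊗ Ω0 n            ≈⟨ state-⊗ˡ ket1 Ω (kets n) ⟩
  Ω0 (suc n)             ∎
  where
  Ω-ket : ∀ b → Ω ⨾ ket b ≈ Ω ⨾ ket1
  Ω-ket true  = ≈-refl
  Ω-ket false = ≈-sym Ω-ket1≈Ω-ket0

Ω-absorbs-Ω0 : ∀ n → Ω ⨾ Ω0 n ≈ Ω0 n
Ω-absorbs-Ω0 n = ≈-trans (⨾-assoc˘ Ω Ω (kets n)) (⨾-congʳ Ω-idem)

Ω-absorbs-basis-⊗ : ∀ {n m} (u : Vec Bool n) (v : Vec Bool m) → Ω ⨾ (basis u ⊗ basis v) ≈ Ω0 (n + m)
Ω-absorbs-basis-⊗ u v = ≈-trans (⨾-congˡ (≈-sym (basis-++ u v))) (Ω-absorbs-basis (u ++ v))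

Ω0-⊗-basis : ∀ {n m} (v : Vec Bool m) → Ω0 n ⊗ basis v ≈ Ω0 (n + m)
Ω0-⊗-basis {n} v = begin
  (Ω ⨾ kets n) ⊗ basis v                   ≈⟨ ≈-sym (scalar-⨾-⊗ Ω (kets n) (basis v)) ⟩
  Ω ⨾ (kets n ⊗ basis v)                   ≈⟨ ⨾-congˡ (⊗-cong (kets≈basis n) ≈-refl) ⟩
  Ω ⨾ (basis (replicate n true) ⊗ basis v) ≈⟨ Ω-absorbs-basis-⊗ (replicate n true) v ⟩
  Ω0 (n + _)                               ∎

basis-⊗-Ω0 : ∀ {n m} (u : Vec Bool n) → basis u ⊗ Ω0 m ≈ Ω0 (n + m)
basis-⊗-Ω0 {m = m} u = begin
  basis u ⊗ (Ω ⨾ kets m)                   ≈⟨ state-⊗ˡ (basis u) Ω (kets m) ⟩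
  Ω ⨾ (basis u ⊗ kets m)                   ≈⟨ ⨾-congˡ (⊗-cong ≈-refl (kets≈basis m)) ⟩
  Ω ⨾ (basis u ⊗ basis (replicate m true)) ≈⟨ Ω-absorbs-basis-⊗ u (replicate m true) ⟩
  Ω0 (_ + m)                               ∎

Ω0-⊗-Ω0 : ∀ n m → Ω0 n ⊗ Ω0 m ≈ Ω0 (n + m)
Ω0-⊗-Ω0 n m = begin
  (Ω ⨾ kets n) ⊗ Ω0 m   ≈⟨ ≈-sym (scalar-⨾-⊗ Ω (kets n) (Ω0 m)) ⟩
  Ω ⨾ (kets n ⊗ Ω0 m)   ≈⟨ ⨾-congˡ (≈-trans (⊗-cong (kets≈basis n) ≈-refl) (basis-⊗-Ω0 (replicate n true))) ⟩
  Ω ⨾ Ω0 (n + m)        ≈⟨ Ω-absorbs-Ω0 (n + m) ⟩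
  Ω0 (n + m)            ∎

basis-σ : ∀ {a b} (u : Vec Bool a) (v : Vec Bool b) → basis (u ++ v) ⨾ σ a b ≈ basis (v ++ u)
basis-σ {a} {b} u v = begin
  basis (u ++ v) ⨾ σ a b         ≈⟨ ⨾-congʳ (basis-++ u v) ⟩
  (basis u ⊗ basis v) ⨾ σ a b    ≈⟨ σ-nat (basis u) (basis v) ⟩
  σ 0 0 ⨾ (basis v ⊗ basis u)    ≈⟨ ⨾-congʳ (σ-unit 0) ⟩
  id 0 ⨾ (basis v ⊗ basis u)     ≈⟨ ⨾-idˡ _ ⟩
  basis v ⊗ basis u              ≈⟨ ≈-sym (basis-++ v u) ⟩
  basis (v ++ u)                 ∎

cnot-basis : ∀ x y → basis (x ∷ y ∷ []) ⨾ cnot ≈ basis (x ∷ (x xor y) ∷ [])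
cnot-basis false y     = cnot-ket0-control (ket y ⊗ id 0)
cnot-basis true  true  = begin
  (ket1 ⊗ ket1 ⊗ id 0) ⨾ cnot   ≈⟨ ⨾-congʳ (⊗-cong ≈-refl (⊗-unitʳ ket1)) ⟩
  (ket1 ⊗ ket1) ⨾ cnot          ≈⟨ cnot-ket1-ket1 ⟩
  ket1 ⊗ ket0                   ≈⟨ ⊗-cong ≈-refl (≈-sym (⊗-unitʳ ket0)) ⟩
  ket1 ⊗ ket0 ⊗ id 0            ∎
cnot-basis true  false = begin
  (ket1 ⊗ ket0 ⊗ id 0) ⨾ cnot   ≈⟨ ⨾-congʳ (⊗-cong ≈-refl (⊗-unitʳ ket0)) ⟩
  (ket1 ⊗ ket0) ⨾ cnot          ≈⟨ cnot-ket1-ket0 ⟩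
  ket1 ⊗ ket1                   ≈⟨ ⊗-cong ≈-refl (≈-sym (⊗-unitʳ ket1)) ⟩
  ket1 ⊗ ket1 ⊗ id 0            ∎

cnot-basis-involutive : ∀ x y → basis (x ∷ (x xor y) ∷ []) ⨾ cnot ≈ basis (x ∷ y ∷ [])
cnot-basis-involutive x y =
  ≈-trans (cnot-basis x (x xor y)) (≡⇒≈ (cong (λ z → basis (x ∷ z ∷ [])) xor-cancelˡ))
  where
  xor-cancelˡ : x xor (x xor y) ≡ y
  xor-cancelˡ = trans (sym (xor-assoc x x y)) (cong (_xor y) (xor-same x))

data BasisAction {a b : ℕ} (h : Tm a b) (u : Vec Bool a) : Set where
  maps-to   : (v : Vec Bool b) → basis u ⨾ h ≈ basis v → basis v ⨾ h ° ≈ basis u → BasisAction h u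
  collapses : basis u ⨾ h ≈ Ω0 b → BasisAction h u

Ω0-⨾ : ∀ {a b} {h : Tm a b} → BasisAction h (replicate a true) → Ω0 a ⨾ h ≈ Ω0 b
Ω0-⨾ {a} {b} {h} act =
  ≈-trans (⨾-assoc Ω (kets a) h) (≈-trans (⨾-congˡ (⨾-congʳ (kets≈basis a))) (absorb act))
  where
  absorb : BasisAction h (replicate a true) → Ω ⨾ basis (replicate a true) ⨾ h ≈ Ω0 b
  absorb (maps-to v fwd _) = ≈-trans (⨾-congˡ fwd) (Ω-absorbs-basis v)
  absorb (collapses r)     = ≈-trans (⨾-congˡ r) (Ω-absorbs-Ω0 b)

⨾-action : ∀ {a b c} {g : Tm a b} {h : Tm b c} {u : Vec Bool a} →
           BasisAction g u → (∀ w → BasisAction h w) → BasisAction (g ⨾ h) u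
⨾-action (maps-to w p q) act-h with act-h w
... | maps-to v p' q' = maps-to v (⨾-chain p p') (⨾-chain q' q)
... | collapses r     = collapses (⨾-chain p r)
⨾-action {b = b} (collapses r) act-h = collapses (⨾-chain r (Ω0-⨾ (act-h (replicate b true))))

basis-⨾-⊗ : ∀ {a b c d} {f : Tm a b} {g : Tm c d} {u₁ : Vec Bool a} {u₂ : Vec Bool c}
              {s : Tm 0 b} {t : Tm 0 d} →
            basis u₁ ⨾ f ≈ s → basis u₂ ⨾ g ≈ t → basis (u₁ ++ u₂) ⨾ (f ⊗ g) ≈ s ⊗ t
basis-⨾-⊗ {f = f} {g} {u₁} {u₂} p q =
  ≈-trans (⨾-congʳ (basis-++ u₁ u₂)) (≈-trans (⊗-interchange (basis u₁) f (basis u₂) g) (⊗-cong p q))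

⊗-action : ∀ {a b c d} {f : Tm a b} {g : Tm c d} {u₁ : Vec Bool a} {u₂ : Vec Bool c} →
           BasisAction f u₁ → BasisAction g u₂ → BasisAction (f ⊗ g) (u₁ ++ u₂)
⊗-action {u₁ = u₁} {u₂} (maps-to v₁ p₁ q₁) (maps-to v₂ p₂ q₂) =
  maps-to (v₁ ++ v₂) (≈-trans (basis-⨾-⊗ p₁ p₂) (≈-sym (basis-++ v₁ v₂)))
                     (≈-trans (basis-⨾-⊗ q₁ q₂) (≈-sym (basis-++ u₁ u₂)))
⊗-action (maps-to v₁ p₁ _) (collapses r₂) = collapses (≈-trans (basis-⨾-⊗ p₁ r₂) (basis-⊗-Ω0 v₁))
⊗-action (collapses r₁) (maps-to v₂ p₂ _) = collapses (≈-trans (basis-⨾-⊗ r₁ p₂) (Ω0-⊗-basis v₂))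
⊗-action {b = b} {d = d} (collapses r₁) (collapses r₂) =
  collapses (≈-trans (basis-⨾-⊗ r₁ r₂) (Ω0-⊗-Ω0 b d))

basis-action : ∀ {a b} (h : Tm a b) (u : Vec Bool a) → BasisAction h u
basis-action (id n)  u = maps-to u (⨾-idʳ (basis u)) (⨾-idʳ (basis u))
basis-action (g ⨾ h) u = ⨾-action (basis-action g u) (basis-action h)
basis-action (_⊗_ {a} f g) u with splitAt a u
... | u₁ , u₂ , refl = ⊗-action (basis-action f u₁) (basis-action g u₂)
basis-action (σ a b) u with splitAt a u
... | u₁ , u₂ , refl = maps-to (u₂ ++ u₁) (basis-σ u₁ u₂) (basis-σ u₂ u₁)
basis-action cnot (x ∷ y ∷ []) = maps-to _ (cnot-basis x y) (cnot-basis-involutive x y)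
basis-action ket1 []           = maps-to (true ∷ []) (≈-trans (⨾-idˡ ket1) (≈-sym (⊗-unitʳ ket1)))
                                                     (≈-trans (⨾-congʳ (⊗-unitʳ ket1)) ax6)
basis-action bra1 (true ∷ [])  = maps-to [] (≈-trans (⨾-congʳ (⊗-unitʳ ket1)) ax6)
                                            (≈-trans (⨾-idˡ ket1) (≈-sym (⊗-unitʳ ket1)))
basis-action bra1 (false ∷ []) = collapses (≈-trans (⨾-congʳ (⊗-unitʳ ket0))
                                                    (≈-trans ket0-bra1 (≈-sym (⨾-idʳ Ω))))

mainTheorem19 : (n : ℕ) (f : Tm 0 n) → Total f ⊎ f ≈ Ω0 n
mainTheorem19 n f with basis-action f []
... | maps-to v fwd bwd = inj₁ (≈-trans (⨾-congʳ (≈-trans (≈-sym (⨾-idˡ f)) fwd)) bwd)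
... | collapses r       = inj₂ (≈-trans (≈-sym (⨾-idˡ f)) r)
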